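{- Let $F$ be the sequential cellular automaton of radius $\frac{1}{2}$ over the alphabet $\Sigma=\mathbb{B}\cup T$ described in the context. For every integer $n\ge 1$ and every $x\in\mathbb{B}^n$ with $|x|_0\neq|x|_1$, let $b\in\mathbb{B}$ be the symbol with $|x|_b>|x|_{1-b}$. Then there exists $K\in\mathbb{N}$ such that $F^k(x)=b^n$ for all $k\ge K$, and $b^n$ is a fixed point of $F$, i.e. $F(b^n)=b^n$. (That is, $F$ solves the density classification task using an intermediate alphabet.) This holds for any choice of the unspecified values in rule (R5).
   Context: Let $\mathbb{B}=\{0,1\}$. For $x\in\mathbb{B}^n$ and $b\in\mathbb{B}$, $|x|_b$ is the number of positions of $x$ equal to $b$. An intermediate symbol is a triple $(c,v,M)$ with counter $c\in\{\circ,\bullet\}$, value $v\in\{0,1,X\}$ and memory $M\subseteq\mathbb{B}$, subject to: if $v\in\mathbb{B}$ then $v\in M$ (this gives 16 triples); $T$ is the set of these triples and $\Sigma=\mathbb{B}\cup T$. For a counter $c$, $\bar c$ denotes the other counter symbol. The local rule $f:\Sigma\times\Sigma\to\Sigma$, $f(a,y)$ with $a$ the left neighbour and $y$ the cell being updated, is: (R1) $f(b,b)=b$ for $b\in\mathbb{B}$; (R2) $f(b,b')=(\circ,X,\{b'\})$ for $b\neq b'$ in $\mathbb{B}$; (R3) for $b\in\mathbb{B}$: $f((c,v,M),b)=(c,X,M\cup\{b\})$ if $b\notin M$, and $f((c,v,M),b)=(c,b,M)$ if $b\in M$; (R4) for $c'\neq c$: $f((c,v,M),(c',w,M'))=(c,X,M\cup\{w\})$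 if $w\in\mathbb{B}\setminus M$, and $=(c,w,M)$ if $w\in M\cup\{X\}$; (R5) $f((c,v,M),(c,w,M'))=(\bar c,X,\emptyset)$ if $M=\mathbb{B}$; $=b$ if $M=\{b\}$; an arbitrary fixed element of $\Sigma$ if $M=\emptyset$; (R6) $f(b,(c,v,M))=b$ for $b\in\mathbb{B}$. Configurations $z\in\Sigma^n$ are cyclic, with cells $1,\dots,n$, the left neighbour of cell $1$ being cell $n$. One application of $F$ (sequential update) performs, for $i=1,2,\dots,n$ in this order, the assignment $z_i:=f(z_{i-1},z_i)$ (with $z_0:=z_n$), each step using the current values (so for $i\ge2$ the already updated $z_{i-1}$ is used, and for $i=1$ the value of $z_n$ left by the previous application). $F^k$ denotes $k$ applications of $F$. -}

module Defs where

open import Data.Nat using (ℕ; zero; suc)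
open import Data.Fin using (Fin; zero; suc)
open import Data.Fin.Subset using (Subset; _∈_; _∪_; ⁅_⁆; inside; outside)
open import Data.Fin.Subset.Properties using (_∈?_)
open import Data.Vec using (Vec; []; _∷_; last)
open import Data.Unit using (⊤; tt)
open import Relation.Nullary using (yes; no)

-- Bits: 𝔹 = {0,1} represented as Fin 2 (zero = 0, suc zero = 1).
𝔹 : Set
𝔹 = Fin 2

data Counter : Set where
  ∘c •c : Counter

bar : Counter → Counter
bar ∘c = •c
bar •c = ∘c

data Val : Set where
  val : 𝔹 → Val
  X   : Val

Valid : Val → Subset 2 → Set
Valid (val b) M = b ∈ M
Valid X       M = ⊤

record Tri : Set where
  constructor tri
  field
    ctr : Counter
    vl  : Val
    mem : Subset 2
    ok  : Valid vl mem

data Sym : Set where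
  bit : 𝔹 → Sym
  tr  : Tri → Sym


-- Local rule f(a, y), parameterised by the unspecified values of (R5) for M = ∅:
-- g (c,v,M) (c',w,M') is the value chosen in that case (any choice allowed).
module Rule (g : Tri → Tri → Sym) where

  absorb : Counter → Subset 2 → 𝔹 → Sym
  absorb c M w with w ∈? M
  ... | yes w∈M = tr (tri c (val w) M w∈M)
  ... | no  _   = tr (tri c X (M ∪ ⁅ w ⁆) tt)

  r5 : Tri → Tri → Sym
  r5 t t' with Tri.mem t
  ... | inside  ∷ inside  ∷ [] = tr (tri (bar (Tri.ctr t)) X (outside ∷ outside ∷ []) tt)
  ... | inside  ∷ outside ∷ [] = bit zero
  ... | outside ∷ inside  ∷ [] = bit (suc zero)
  ... | outside ∷ outside ∷ [] = g t t'

  r4 : Tri → Tri → Sym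
  r4 (tri c v M p) (tri c' (val w) M' p') = absorb c M w
  r4 (tri c v M p) (tri c' X M' p')       = tr (tri c X M tt)

  f : Sym → Sym → Sym
  f (bit zero)       (bit zero)       = bit zero
  f (bit (suc zero)) (bit (suc zero)) = bit (suc zero)
  f (bit zero)       (bit (suc zero)) = tr (tri ∘c X ⁅ suc zero ⁆ tt)
  f (bit (suc zero)) (bit zero)       = tr (tri ∘c X ⁅ zero ⁆ tt)
  f (tr (tri c v M p)) (bit b)        = absorb c M b
  f (bit b)          (tr _)           = bit b
  f (tr t) (tr t') with Tri.ctr t | Tri.ctr t'
  ... | ∘c | ∘c = r5 t t'
  ... | •c | •c = r5 t t'
  ... | ∘c | •c = r4 t t'
  ... | •c | ∘c = r4 t t'

  -- Sequential sweep: cell i is updated from the current (already updated) left neighbour.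
  sweep : ∀ {m} → Sym → Vec Sym m → Vec Sym m
  sweep a []       = []
  sweep a (y ∷ ys) = let y' = f a y in y' ∷ sweep y' ys

  -- One application of F on a cyclic configuration of n+1 cells:
  -- cell 1 uses the (not yet updated) cell n as its left neighbour.
  F : ∀ {n} → Vec Sym (suc n) → Vec Sym (suc n)
  F z = sweep (last z) z

iter : ∀ {A : Set} → ℕ → (A → A) → A → A
iter zero    h a = a
iter (suc k) h a = h (iter k h a)

-- A 01 or 10 border creates a head (∘, X, {y}) which travels around the ring while the cells
-- behind it keep updating.  On its way the head absorbs, via (R3)/(R4), the first 0 and the
-- first 1 it meets that are not yet in its memory, so one full turn removes one occurrence of
-- every value present.  Back at its own trace (R5), a head that has seen both values restarts
-- with the other counter and empty memory; otherwise it has seen only the majority value b and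
-- turns into the bit b, which then overwrites the intermediate symbols by (R6).  The minority
-- count drops by one per turn while the majority stays strictly ahead, so the second outcome
-- is eventually reached.
module Submission where

open import Defs
open import Data.Nat using (ℕ; suc; _<_; _≥_)
open import Data.Fin using (_≟_)
open import Data.Vec using (Vec; map; replicate; count)
open import Data.Product using (∃; _×_)
open import Relation.Binary.PropositionalEquality using (_≡_; _≢_)

open import Data.Nat using (zero; _+_; _*_; _∸_; _≤_; z≤n; s≤s)
open import Data.Nat.Properties using (+-comm; +-suc; m+[n∸m]≡n; ≤-trans; m≤m*n; ∸-monoˡ-≤; n≮0; 1+n≢0)
open import Data.Fin using (zero; suc)
open import Data.Fin.Subset using (Subset; _∈_; _∉_; _∪_; ⁅_⁆; inside; outside) renaming (⊥ to ∅)
open import Data.Fin.Subset.Properties using (_∈?_; x∈p∪q⁻; x∈p∪q⁺; x∈⁅x⁆; x∈⁅y⁆⇒x≡y; ∉⊥)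
open import Data.List as List using (List; []; _∷_; _++_; _∷ʳ_; length; foldl)
open import Data.List.Properties using (++-assoc; ++-identityʳ; length-++; length-map; map-++; map-∘; map-replicate; foldl-++; foldl-∷ʳ)
open import Data.List.Relation.Unary.All using (All; []; _∷_)
open import Data.Vec using ([]; _∷_; toList; last; here; there)
open import Data.Vec.Properties using (toList-map; toList-replicate; toList-injective; cast-is-id; length-toList)
open import Data.Product using (_,_; ∃-syntax)
open import Data.Sum using (_⊎_; inj₁; inj₂)
open import Data.Unit using (tt)
open import Relation.Nullary using (yes; no; contradiction)
open import Relation.Binary.Definitions using (DecidableEquality)
open import Relation.Binary.PropositionalEquality using (refl; sym; trans; cong; subst; subst₂; module ≡-Reasoning)
open ≡-Reasoning

lastOr : {A : Set} → A → List A → A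
lastOr = foldl (λ _ y → y)

lastOr-++ : ∀ {A : Set} (d : A) xs ys → lastOr d (xs ++ ys) ≡ lastOr (lastOr d xs) ys
lastOr-++ = foldl-++ _

lastOr-∷ʳ : ∀ {A : Set} (d : A) xs y → lastOr d (xs ∷ʳ y) ≡ y
lastOr-∷ʳ d xs y = foldl-∷ʳ _ d y xs

lastOr-replicate : ∀ {A : Set} k (x : A) → lastOr x (List.replicate k x) ≡ x
lastOr-replicate zero    x = refl
lastOr-replicate (suc k) x = lastOr-replicate k x

lastOr-map : ∀ {A B : Set} (h : A → B) d xs → lastOr (h d) (List.map h xs) ≡ h (lastOr d xs)
lastOr-map h d []       = refl
lastOr-map h d (x ∷ xs) = lastOr-map h x xs

replicate-∷ʳ : ∀ {A : Set} k (x : A) → List.replicate k x ∷ʳ x ≡ x ∷ List.replicate k x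
replicate-∷ʳ zero    x = refl
replicate-∷ʳ (suc k) x = cong (x ∷_) (replicate-∷ʳ k x)

replicate⊎break : ∀ {A : Set} → DecidableEquality A → (a : A) (xs : List A) →
  xs ≡ List.replicate (length xs) a
  ⊎ ∃[ k ] ∃[ y ] ∃[ zs ] xs ≡ List.replicate k a ++ y ∷ zs × y ≢ a
replicate⊎break _≟A_ a [] = inj₁ refl
replicate⊎break _≟A_ a (x ∷ xs) with x ≟A a
... | no x≢a = inj₂ (0 , x , xs , refl , x≢a)
... | yes refl with replicate⊎break _≟A_ a xs
...   | inj₁ e                      = inj₁ (cong (a ∷_) e)
...   | inj₂ (k , y , zs , e , y≢a) = inj₂ (suc k , y , zs , cong (a ∷_) e , y≢a)

toList-injective′ : ∀ {A : Set} {n} (u v : Vec A n) → toList u ≡ toList v → u ≡ v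
toList-injective′ u v e = trans (sym (cast-is-id refl u)) (toList-injective refl u v e)

last≡lastOr : ∀ {A : Set} {n} d (z : Vec A (suc n)) → last z ≡ lastOr d (toList z)
last≡lastOr d (x ∷ [])     = refl
last≡lastOr d (x ∷ y ∷ z) = last≡lastOr d (y ∷ z)

other : 𝔹 → 𝔹
other zero       = suc zero
other (suc zero) = zero

other-≢ : ∀ w → other w ≢ w
other-≢ zero       ()
other-≢ (suc zero) ()

valOf : Sym → Val
valOf (bit w) = val w
valOf (tr t)  = Tri.vl t

vals : List Sym → List Val
vals = List.map valOf

occ : 𝔹 → List Val → ℕ
occ w []           = 0
occ w (X ∷ vs)     = occ w vs
occ w (val u ∷ vs) with u ≟ w
... | yes _ = suc (occ w vs)
... | no _  = occ w vs

occ-++ : ∀ w us vs → occ w (us ++ vs) ≡ occ w us + occ w vs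
occ-++ w []           vs = refl
occ-++ w (X ∷ us)     vs = occ-++ w us vs
occ-++ w (val u ∷ us) vs with u ≟ w
... | yes _ = cong suc (occ-++ w us vs)
... | no _  = occ-++ w us vs

occ-map-val-++-comm : ∀ w us vs → occ w (List.map val (us ++ vs)) ≡ occ w (List.map val (vs ++ us))
occ-map-val-++-comm w us vs = begin
  occ w (List.map val (us ++ vs))                   ≡⟨ cong (occ w) (map-++ val us vs) ⟩
  occ w (List.map val us ++ List.map val vs)        ≡⟨ occ-++ w (List.map val us) _ ⟩
  occ w (List.map val us) + occ w (List.map val vs) ≡⟨ +-comm (occ w (List.map val us)) _ ⟩
  occ w (List.map val vs) + occ w (List.map val us) ≡⟨ sym (occ-++ w (List.map val vs) _) ⟩
  occ w (List.map val vs ++ List.map val us)        ≡⟨ cong (occ w) (sym (map-++ val vs us)) ⟩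
  occ w (List.map val (vs ++ us))                   ∎

occ-replicate-≢ : ∀ {u w} k → u ≢ w → occ w (List.replicate k (val u)) ≡ 0
occ-replicate-≢ zero u≢w = refl
occ-replicate-≢ {u} {w} (suc k) u≢w with u ≟ w
... | yes u≡w = contradiction u≡w u≢w
... | no _    = occ-replicate-≢ k u≢w

constant-majority : ∀ {a b} ys → ys ≡ List.replicate (length ys) a →
  occ (other b) (List.map val ys) < occ b (List.map val ys) → a ≡ b
constant-majority {a} {b} ys e majority with a ≟ b
... | yes a≡b = a≡b
... | no a≢b  = contradiction (subst (occ (other b) (List.map val ys) <_) b-absent majority) n≮0
  where
    b-absent : occ b (List.map val ys) ≡ 0
    b-absent = begin
      occ b (List.map val ys)                                 ≡⟨ cong (λ l → occ b (List.map val l)) e ⟩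
      occ b (List.map val (List.replicate (length ys) a))     ≡⟨ cong (occ b) (map-replicate val (length ys) a) ⟩
      occ b (List.replicate (length ys) (val a))              ≡⟨ occ-replicate-≢ (length ys) a≢b ⟩
      0                                                       ∎

count≡occ : ∀ {n} w (x : Vec 𝔹 n) → count (_≟ w) x ≡ occ w (List.map val (toList x))
count≡occ w []      = refl
count≡occ w (u ∷ x) with u ≟ w
... | yes _ = cong suc (count≡occ w x)
... | no _  = count≡occ w x

-- A head (c, X, M) moving right through cells of values vs leaves the triples trail c M vs
-- behind; its memory is then finM M vs, and residue M vs lists the values it left behind.
crossVal : Subset 2 → Val → Val
crossVal M X = X
crossVal M (val w) with w ∈? M
... | yes _ = val w
... | no _  = X

nextM : Subset 2 → Val → Subset 2
nextM M X = M
nextM M (val w) with w ∈? M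
... | yes _ = M
... | no _  = M ∪ ⁅ w ⁆

crossVal-valid : ∀ M v → Valid (crossVal M v) (nextM M v)
crossVal-valid M X = tt
crossVal-valid M (val w) with w ∈? M
... | yes w∈M = w∈M
... | no _    = tt

crossed : Counter → Subset 2 → Val → Tri
crossed c M v = tri c (crossVal M v) (nextM M v) (crossVal-valid M v)

trail : Counter → Subset 2 → List Val → List Tri
trail c M []       = []
trail c M (v ∷ vs) = crossed c M v ∷ trail c (nextM M v) vs

finM : Subset 2 → List Val → Subset 2
finM M []       = M
finM M (v ∷ vs) = finM (nextM M v) vs

residue : Subset 2 → List Val → List Val
residue M []       = []
residue M (v ∷ vs) = crossVal M v ∷ residue (nextM M v) vs

vals-trail : ∀ c M vs → vals (List.map tr (trail c M vs)) ≡ residue M vs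
vals-trail c M []       = refl
vals-trail c M (v ∷ vs) = cong (crossVal M v ∷_) (vals-trail c (nextM M v) vs)

last-trail : ∀ c M vs v p →
  ∃[ v′ ] ∃[ p′ ] lastOr (tri c v M p) (trail c M vs) ≡ tri c v′ (finM M vs) p′
last-trail c M []        v p = v , p , refl
last-trail c M (v₁ ∷ vs) v p = last-trail c (nextM M v₁) vs (crossVal M v₁) (crossVal-valid M v₁)

∈-∪⁅⁆ : ∀ w (M : Subset 2) → w ∈ M ∪ ⁅ w ⁆
∈-∪⁅⁆ w M = x∈p∪q⁺ (inj₂ (x∈⁅x⁆ w))

∉-∪⁅⁆ : ∀ {w u} {M : Subset 2} → w ∉ M → u ≢ w → w ∉ M ∪ ⁅ u ⁆
∉-∪⁅⁆ {w} {u} {M} w∉M u≢w w∈ with x∈p∪q⁻ M ⁅ u ⁆ w∈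
... | inj₁ w∈M = w∉M w∈M
... | inj₂ w∈u = u≢w (sym (x∈⁅y⁆⇒x≡y u w∈u))

∈-nextM : ∀ {w} M v → w ∈ M → w ∈ nextM M v
∈-nextM M X       w∈M = w∈M
∈-nextM M (val u) w∈M with u ∈? M
... | yes _ = w∈M
... | no _  = x∈p∪q⁺ (inj₁ w∈M)

∈-finM : ∀ {w} M vs → w ∈ M → w ∈ finM M vs
∈-finM M []       w∈M = w∈M
∈-finM M (v ∷ vs) w∈M = ∈-finM (nextM M v) vs (∈-nextM M v w∈M)

occ-pos⇒∈finM : ∀ w M vs → 0 < occ w vs → w ∈ finM M vs
occ-pos⇒∈finM w M (X ∷ vs)     pos = occ-pos⇒∈finM w M vs pos
occ-pos⇒∈finM w M (val u ∷ vs) pos with u ≟ w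
... | no _    = occ-pos⇒∈finM w (nextM M (val u)) vs pos
... | yes refl with u ∈? M
...   | yes u∈M = ∈-finM M vs u∈M
...   | no _    = ∈-finM (M ∪ ⁅ u ⁆) vs (∈-∪⁅⁆ u M)

occ-zero⇒∉finM : ∀ w M vs → w ∉ M → occ w vs ≡ 0 → w ∉ finM M vs
occ-zero⇒∉finM w M []           w∉M _ = w∉M
occ-zero⇒∉finM w M (X ∷ vs)     w∉M z = occ-zero⇒∉finM w M vs w∉M z
occ-zero⇒∉finM w M (val u ∷ vs) w∉M z with u ≟ w
... | yes _ = contradiction z 1+n≢0
... | no u≢w with u ∈? M
...   | yes _ = occ-zero⇒∉finM w M vs w∉M z
...   | no _  = occ-zero⇒∉finM w (M ∪ ⁅ u ⁆) vs (∉-∪⁅⁆ w∉M u≢w) z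

occ-residue-∈ : ∀ w M vs → w ∈ M → occ w (residue M vs) ≡ occ w vs
occ-residue-∈ w M []           w∈M = refl
occ-residue-∈ w M (X ∷ vs)     w∈M = occ-residue-∈ w M vs w∈M
occ-residue-∈ w M (val u ∷ vs) w∈M with u ∈? M
... | yes _ with u ≟ w
...   | yes _ = cong suc (occ-residue-∈ w M vs w∈M)
...   | no _  = occ-residue-∈ w M vs w∈M
occ-residue-∈ w M (val u ∷ vs) w∈M | no u∉M with u ≟ w
...   | yes refl = contradiction w∈M u∉M
...   | no _     = occ-residue-∈ w (M ∪ ⁅ u ⁆) vs (x∈p∪q⁺ (inj₁ w∈M))

occ-residue-∉ : ∀ w M vs → w ∉ M → occ w (residue M vs) ≡ occ w vs ∸ 1
occ-residue-∉ w M []           w∉M = refl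
occ-residue-∉ w M (X ∷ vs)     w∉M = occ-residue-∉ w M vs w∉M
occ-residue-∉ w M (val u ∷ vs) w∉M with u ∈? M
... | yes u∈M with u ≟ w
...   | yes refl = contradiction u∈M w∉M
...   | no _     = occ-residue-∉ w M vs w∉M
occ-residue-∉ w M (val u ∷ vs) w∉M | no _ with u ≟ w
...   | yes refl = occ-residue-∈ w (M ∪ ⁅ w ⁆) vs (∈-∪⁅⁆ w M)
...   | no u≢w   = occ-residue-∉ w (M ∪ ⁅ u ⁆) vs (∉-∪⁅⁆ w∉M u≢w)

member : 𝔹 → Subset 2 → ℕ
member w M with w ∈? M
... | yes _ = 1
... | no _  = 0

-- The number of w's in the ring when the head's current turn began: those still ahead of
-- it, plus the one it absorbed if w is in its memory.
weight : 𝔹 → Subset 2 → List Val → ℕ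
weight w M vs = member w M + occ w vs

weight-⁅⁆ : ∀ w u vs → weight w ⁅ u ⁆ vs ≡ occ w (val u ∷ vs)
weight-⁅⁆ zero       zero       vs = refl
weight-⁅⁆ zero       (suc zero) vs = refl
weight-⁅⁆ (suc zero) zero       vs = refl
weight-⁅⁆ (suc zero) (suc zero) vs = refl

weight-∅ : ∀ w vs → weight w ∅ vs ≡ occ w vs
weight-∅ w vs with w ∈? ∅
... | yes w∈∅ = contradiction w∈∅ ∉⊥
... | no _    = refl

weight-residue : ∀ w M vs → weight w ∅ (residue M vs) ≡ weight w M vs ∸ 1
weight-residue w M vs with w ∈? M
... | yes w∈M = trans (weight-∅ w (residue M vs)) (occ-residue-∈ w M vs w∈M)
... | no w∉M  = trans (weight-∅ w (residue M vs)) (occ-residue-∉ w M vs w∉M)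

weight-pos⇒∈finM : ∀ w M vs → 0 < weight w M vs → w ∈ finM M vs
weight-pos⇒∈finM w M vs pos with w ∈? M
... | yes w∈M = ∈-finM M vs w∈M
... | no _    = occ-pos⇒∈finM w M vs pos

weight-zero⇒∉finM : ∀ w M vs → weight w M vs ≡ 0 → w ∉ finM M vs
weight-zero⇒∉finM w M vs z with w ∈? M
... | yes _   = contradiction z 1+n≢0
... | no w∉M  = occ-zero⇒∉finM w M vs w∉M z

module Dynamics (g : Tri → Tri → Sym) where
  open Rule g

  f-quiescent : ∀ w → f (bit w) (bit w) ≡ bit w
  f-quiescent zero       = refl
  f-quiescent (suc zero) = refl

  f-bit-tri : ∀ w t → f (bit w) (tr t) ≡ bit w
  f-bit-tri zero       t = refl
  f-bit-tri (suc zero) t = refl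

  f-border : ∀ {a y} → y ≢ a → f (bit a) (bit y) ≡ tr (tri ∘c X ⁅ y ⁆ tt)
  f-border {zero}     {zero}     y≢a = contradiction refl y≢a
  f-border {zero}     {suc zero} y≢a = refl
  f-border {suc zero} {zero}     y≢a = refl
  f-border {suc zero} {suc zero} y≢a = contradiction refl y≢a

  f-same-counter : ∀ {c v M p v′ M′ p′} →
    f (tr (tri c v M p)) (tr (tri c v′ M′ p′)) ≡ r5 (tri c v M p) (tri c v′ M′ p′)
  f-same-counter {∘c} = refl
  f-same-counter {•c} = refl

  head : Counter → Subset 2 → Sym
  head c M = tr (tri c X M tt)

  r5-full : ∀ w {c v M p t′} → w ∈ M → other w ∈ M → r5 (tri c v M p) t′ ≡ head (bar c) ∅
  r5-full zero       {M = _ ∷ _ ∷ []} here         (there here) = refl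
  r5-full (suc zero) {M = _ ∷ _ ∷ []} (there here) here         = refl

  r5-single : ∀ w {c v M p t′} → w ∈ M → other w ∉ M → r5 (tri c v M p) t′ ≡ bit w
  r5-single zero       {M = inside ∷ inside ∷ []}  here         o∉M = contradiction (there here) o∉M
  r5-single zero       {M = inside ∷ outside ∷ []} here         o∉M = refl
  r5-single (suc zero) {M = inside ∷ inside ∷ []}  (there here) o∉M = contradiction here o∉M
  r5-single (suc zero) {M = outside ∷ inside ∷ []} (there here) o∉M = refl

  -- A list y ∷ ys stands for the ring read from the next cell to update, y, whose left
  -- neighbour is the last element; tick updates y and rotates it to the back.
  tick : List Sym → List Sym
  tick []       = []
  tick (y ∷ ys) = ys ∷ʳ f (lastOr y ys) y

  ticks : ℕ → List Sym → List Sym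
  ticks zero    w = w
  ticks (suc k) w = ticks k (tick w)

  ticks-+ : ∀ m k w → ticks (m + k) w ≡ ticks k (ticks m w)
  ticks-+ zero    k w = refl
  ticks-+ (suc m) k w = ticks-+ m k (tick w)

  length-tick : ∀ w → length (tick w) ≡ length w
  length-tick []       = refl
  length-tick (y ∷ ys) = trans (length-++ ys) (+-comm (length ys) 1)

  length-ticks : ∀ k w → length (ticks k w) ≡ length w
  length-ticks zero    w = refl
  length-ticks (suc k) w = trans (length-ticks k (tick w)) (length-tick w)

  tick-replicate : ∀ {s} → f s s ≡ s → ∀ k → tick (List.replicate k s) ≡ List.replicate k s
  tick-replicate q zero        = refl
  tick-replicate {s} q (suc k) = begin
    List.replicate k s ∷ʳ f (lastOr s (List.replicate k s)) s ≡⟨ cong (λ a → List.replicate k s ∷ʳ f a s) (lastOr-replicate k s) ⟩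
    List.replicate k s ∷ʳ f s s                              ≡⟨ cong (List.replicate k s ∷ʳ_) q ⟩
    List.replicate k s ∷ʳ s                                  ≡⟨ replicate-∷ʳ k s ⟩
    List.replicate (suc k) s                                 ∎

  ticks-replicate : ∀ {s} → f s s ≡ s → ∀ t k → ticks t (List.replicate k s) ≡ List.replicate k s
  ticks-replicate q zero    k = refl
  ticks-replicate q (suc t) k = trans (cong (ticks t) (tick-replicate q k)) (ticks-replicate q t k)

  ticks-rotate : ∀ {s} → f s s ≡ s → ∀ k us → lastOr s us ≡ s →
    ticks k (List.replicate k s ++ us) ≡ us ++ List.replicate k s
  ticks-rotate q zero us _ = sym (++-identityʳ us)
  ticks-rotate {s} q (suc k) us last≡s = begin
    ticks k ((List.replicate k s ++ us) ∷ʳ f (lastOr s (List.replicate k s ++ us)) s)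
      ≡⟨ cong (λ a → ticks k ((List.replicate k s ++ us) ∷ʳ f a s)) last≡s′ ⟩
    ticks k ((List.replicate k s ++ us) ∷ʳ f s s)
      ≡⟨ cong (λ a → ticks k ((List.replicate k s ++ us) ∷ʳ a)) q ⟩
    ticks k ((List.replicate k s ++ us) ∷ʳ s)
      ≡⟨ cong (ticks k) (++-assoc (List.replicate k s) us _) ⟩
    ticks k (List.replicate k s ++ us ∷ʳ s)
      ≡⟨ ticks-rotate q k (us ∷ʳ s) (lastOr-∷ʳ s us s) ⟩
    (us ∷ʳ s) ++ List.replicate k s
      ≡⟨ ++-assoc us _ _ ⟩
    us ++ List.replicate (suc k) s ∎
    where
      last≡s′ : lastOr s (List.replicate k s ++ us) ≡ s
      last≡s′ = trans (lastOr-++ s (List.replicate k s) us)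
                      (trans (cong (λ a → lastOr a us) (lastOr-replicate k s)) last≡s)

  ticks-sweep : ∀ {m} (ys : Vec Sym m) zs d →
    ticks m (toList ys ++ zs) ≡ zs ++ toList (sweep (lastOr d (toList ys ++ zs)) ys)
  ticks-sweep []       zs d = sym (++-identityʳ zs)
  ticks-sweep {suc m} (y ∷ ys) zs d = begin
    ticks m ((toList ys ++ zs) ∷ʳ x)               ≡⟨ cong (ticks m) (++-assoc (toList ys) zs _) ⟩
    ticks m (toList ys ++ zs ∷ʳ x)                 ≡⟨ ticks-sweep ys (zs ∷ʳ x) d ⟩
    (zs ∷ʳ x) ++ toList (sweep (lastOr d (toList ys ++ zs ∷ʳ x)) ys)
      ≡⟨ cong (λ a → (zs ∷ʳ x) ++ toList (sweep a ys)) last≡x ⟩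
    (zs ∷ʳ x) ++ toList (sweep x ys)               ≡⟨ ++-assoc zs _ _ ⟩
    zs ++ x ∷ toList (sweep x ys)                  ∎
    where
      x = f (lastOr y (toList ys ++ zs)) y
      last≡x : lastOr d (toList ys ++ zs ∷ʳ x) ≡ x
      last≡x = trans (cong (lastOr d) (sym (++-assoc (toList ys) zs _))) (lastOr-∷ʳ d (toList ys ++ zs) x)

  toList-F : ∀ {n} (z : Vec Sym (suc n)) → toList (F z) ≡ ticks (suc n) (toList z)
  toList-F {n} z = begin
    toList (sweep (last z) z)                          ≡⟨ cong (λ a → toList (sweep a z)) last≡ ⟩
    toList (sweep (lastOr (last z) (toList z ++ [])) z) ≡⟨ sym (ticks-sweep z [] (last z)) ⟩
    ticks (suc n) (toList z ++ [])                     ≡⟨ cong (ticks (suc n)) (++-identityʳ (toList z)) ⟩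
    ticks (suc n) (toList z)                           ∎
    where
      last≡ : last z ≡ lastOr (last z) (toList z ++ [])
      last≡ = trans (last≡lastOr (last z) z) (cong (lastOr (last z)) (sym (++-identityʳ (toList z))))

  toList-iter-F : ∀ {n} k (z : Vec Sym (suc n)) → toList (iter k F z) ≡ ticks (k * suc n) (toList z)
  toList-iter-F     zero    z = refl
  toList-iter-F {n} (suc k) z = begin
    toList (F (iter k F z))                      ≡⟨ toList-F (iter k F z) ⟩
    ticks (suc n) (toList (iter k F z))          ≡⟨ cong (ticks (suc n)) (toList-iter-F k z) ⟩
    ticks (suc n) (ticks (k * suc n) (toList z)) ≡⟨ sym (ticks-+ (k * suc n) (suc n) _) ⟩
    ticks (k * suc n + suc n) (toList z)         ≡⟨ cong (λ m → ticks m (toList z)) (+-comm (k * suc n) (suc n)) ⟩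
    ticks (suc n + k * suc n) (toList z)         ∎

  F-replicate : ∀ {n s} → f s s ≡ s → F (replicate (suc n) s) ≡ replicate (suc n) s
  F-replicate {n} {s} q = toList-injective′ _ _ (begin
    toList (F (replicate (suc n) s))          ≡⟨ toList-F (replicate (suc n) s) ⟩
    ticks (suc n) (toList (replicate (suc n) s)) ≡⟨ cong (ticks (suc n)) (toList-replicate (suc n) s) ⟩
    ticks (suc n) (List.replicate (suc n) s)  ≡⟨ ticks-replicate q (suc n) (suc n) ⟩
    List.replicate (suc n) s                  ≡⟨ sym (toList-replicate (suc n) s) ⟩
    toList (replicate (suc n) s)              ∎)

  iter-F-stable : ∀ {n s T} (z : Vec Sym (suc n)) → f s s ≡ s →
    ticks T (toList z) ≡ List.replicate (suc n) s → ∀ k → k ≥ T → iter k F z ≡ replicate (suc n) s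
  iter-F-stable {n} {s} {T} z q reach k k≥T = toList-injective′ _ _ (begin
    toList (iter k F z)                         ≡⟨ toList-iter-F k z ⟩
    ticks (k * suc n) (toList z)                ≡⟨ cong (λ m → ticks m (toList z)) (sym (m+[n∸m]≡n T≤kn)) ⟩
    ticks (T + (k * suc n ∸ T)) (toList z)      ≡⟨ ticks-+ T _ _ ⟩
    ticks (k * suc n ∸ T) (ticks T (toList z))  ≡⟨ cong (ticks (k * suc n ∸ T)) reach ⟩
    ticks (k * suc n ∸ T) (List.replicate (suc n) s) ≡⟨ ticks-replicate q (k * suc n ∸ T) (suc n) ⟩
    List.replicate (suc n) s                    ≡⟨ sym (toList-replicate (suc n) s) ⟩
    toList (replicate (suc n) s)                ∎)
    where
      T≤kn : T ≤ k * suc n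
      T≤kn = ≤-trans k≥T (m≤m*n k (suc n))

  data Crossable (c : Counter) : Sym → Set where
    bit : ∀ w → Crossable c (bit w)
    tr  : ∀ {t} → Tri.ctr t ≡ bar c → Crossable c (tr t)

  f-crosses : ∀ {c v M p o} → Crossable c o → f (tr (tri c v M p)) o ≡ tr (crossed c M (valOf o))
  f-crosses {M = M} (bit w) with w ∈? M
  ... | yes _ = refl
  ... | no _  = refl
  f-crosses {∘c} {M = M} (tr {tri •c (val w) _ _} refl) with w ∈? M
  ... | yes _ = refl
  ... | no _  = refl
  f-crosses {•c} {M = M} (tr {tri ∘c (val w) _ _} refl) with w ∈? M
  ... | yes _ = refl
  ... | no _  = refl
  f-crosses {∘c} (tr {tri •c X _ _} refl) = refl
  f-crosses {•c} (tr {tri ∘c X _ _} refl) = refl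

  bits-crossable : ∀ c xs → All (Crossable c) (List.map bit xs)
  bits-crossable c []       = []
  bits-crossable c (x ∷ xs) = bit x ∷ bits-crossable c xs

  trail-crossable : ∀ c M vs → All (Crossable (bar c)) (List.map tr (trail c M vs))
  trail-crossable c M []       = []
  trail-crossable c M (v ∷ vs) = tr (bar-bar c) ∷ trail-crossable c (nextM M v) vs
    where
      bar-bar : ∀ c → c ≡ bar (bar c)
      bar-bar ∘c = refl
      bar-bar •c = refl

  ticks-cross : ∀ {c v M p} olds n₀ ns → All (Crossable c) olds → lastOr n₀ ns ≡ tr (tri c v M p) →
    ticks (length olds) (olds ++ n₀ ∷ ns) ≡ (n₀ ∷ ns) ++ List.map tr (trail c M (vals olds))
  ticks-cross []       n₀ ns []        _      = sym (++-identityʳ _)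
  ticks-cross {c} {v} {M} {p} (o ∷ os) n₀ ns (co ∷ cos) last≡ = begin
    ticks (length os) ((os ++ n₀ ∷ ns) ∷ʳ f (lastOr o (os ++ n₀ ∷ ns)) o)
      ≡⟨ cong (λ a → ticks (length os) ((os ++ n₀ ∷ ns) ∷ʳ a)) updated ⟩
    ticks (length os) ((os ++ n₀ ∷ ns) ∷ʳ x)
      ≡⟨ cong (ticks (length os)) (++-assoc os (n₀ ∷ ns) _) ⟩
    ticks (length os) (os ++ n₀ ∷ ns ∷ʳ x)
      ≡⟨ ticks-cross os n₀ (ns ∷ʳ x) cos (lastOr-∷ʳ n₀ ns x) ⟩
    (n₀ ∷ ns ∷ʳ x) ++ List.map tr (trail c (nextM M (valOf o)) (vals os))
      ≡⟨ ++-assoc (n₀ ∷ ns) _ _ ⟩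
    (n₀ ∷ ns) ++ List.map tr (trail c M (vals (o ∷ os))) ∎
    where
      x = tr (crossed c M (valOf o))
      updated : f (lastOr o (os ++ n₀ ∷ ns)) o ≡ x
      updated = trans (cong (λ a → f a o) (trans (lastOr-++ o os (n₀ ∷ ns)) last≡)) (f-crosses co)

  ticks-round : ∀ {c} M olds → All (Crossable c) olds →
    ∃[ v ] ∃[ p ] ticks (length olds + 1) (olds ∷ʳ head c M)
                  ≡ List.map tr (trail c M (vals olds)) ∷ʳ f (tr (tri c v (finM M (vals olds)) p)) (head c M)
  ticks-round {c} M olds cos with last-trail c M (vals olds) X tt
  ... | v , p , last≡ = v , p , (begin
    ticks (length olds + 1) (olds ∷ʳ head c M)       ≡⟨ ticks-+ (length olds) 1 _ ⟩
    tick (ticks (length olds) (olds ∷ʳ head c M))    ≡⟨ cong tick (ticks-cross olds (head c M) [] cos refl) ⟩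
    tick (head c M ∷ trail′)                         ≡⟨ cong (λ a → trail′ ∷ʳ f a (head c M)) last≡′ ⟩
    trail′ ∷ʳ f (tr (tri c v (finM M (vals olds)) p)) (head c M) ∎)
    where
      trail′ = List.map tr (trail c M (vals olds))
      last≡′ : lastOr (head c M) trail′ ≡ tr (tri c v (finM M (vals olds)) p)
      last≡′ = trans (lastOr-map tr (tri c X M tt) (trail c M (vals olds))) (cong tr last≡)

  ticks-flood : ∀ w ts m → ticks (length ts) (List.map tr ts ++ List.replicate (suc m) (bit w))
                     ≡ List.replicate (length ts + suc m) (bit w)
  ticks-flood w []       m = refl
  ticks-flood w (t ∷ ts) m = begin
    ticks (length ts) ((List.map tr ts ++ bits (suc m)) ∷ʳ f (lastOr (tr t) (List.map tr ts ++ bits (suc m))) (tr t))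
      ≡⟨ cong (λ a → ticks (length ts) ((List.map tr ts ++ bits (suc m)) ∷ʳ f a (tr t))) last≡ ⟩
    ticks (length ts) ((List.map tr ts ++ bits (suc m)) ∷ʳ f (bit w) (tr t))
      ≡⟨ cong (λ a → ticks (length ts) ((List.map tr ts ++ bits (suc m)) ∷ʳ a)) (f-bit-tri w t) ⟩
    ticks (length ts) ((List.map tr ts ++ bits (suc m)) ∷ʳ bit w)
      ≡⟨ cong (ticks (length ts)) (trans (++-assoc (List.map tr ts) _ _)
                                         (cong (List.map tr ts ++_) (replicate-∷ʳ (suc m) (bit w)))) ⟩
    ticks (length ts) (List.map tr ts ++ bits (suc (suc m)))
      ≡⟨ ticks-flood w ts (suc m) ⟩
    bits (length ts + suc (suc m))
      ≡⟨ cong bits (+-suc (length ts) (suc m)) ⟩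
    bits (suc (length ts) + suc m) ∎
    where
      bits : ℕ → List Sym
      bits k = List.replicate k (bit w)
      last≡ : lastOr (tr t) (List.map tr ts ++ bits (suc m)) ≡ bit w
      last≡ = trans (lastOr-++ (tr t) (List.map tr ts) _) (lastOr-replicate m (bit w))

  module Majority (b : 𝔹) where

    Reaches : List Sym → Set
    Reaches w = ∃[ T ] ticks T w ≡ List.replicate (length w) (bit b)

    reaches-via : ∀ m {w w′} → ticks m w ≡ w′ → Reaches w′ → Reaches w
    reaches-via m {w} refl (T , reach) =
      m + T , trans (ticks-+ m T w) (trans reach (cong (λ l → List.replicate l (bit b)) (length-ticks m w)))

    reaches-flood : ∀ ts → Reaches (List.map tr ts ∷ʳ bit b)
    reaches-flood ts = length ts , trans (ticks-flood b ts 0) (cong (λ l → List.replicate l (bit b)) (sym length≡))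
      where
        length≡ : length (List.map tr ts ∷ʳ bit b) ≡ length ts + 1
        length≡ = trans (length-++ (List.map tr ts)) (cong (_+ 1) (length-map tr ts))

    reaches-head : ∀ k {c} M olds → All (Crossable c) olds →
      weight (other b) M (vals olds) ≡ k → weight (other b) M (vals olds) < weight b M (vals olds) →
      Reaches (olds ∷ʳ head c M)
    reaches-head k {c} M olds cos minority majority with ticks-round M olds cos
    ... | v , p , e = reaches-via (length olds + 1) e (close k minority)
      where
        vs = vals olds
        -- b survives every turn, so the memory closing it is never empty and the arbitrary
        -- value g of (R5) never occurs.
        b∈ : b ∈ finM M vs
        b∈ = weight-pos⇒∈finM b M vs (≤-trans (s≤s z≤n) majority)

        trail′ = List.map tr (trail c M vs)
        f-closes : ∀ {s} → r5 (tri c v (finM M vs) p) (tri c X M tt) ≡ s → Reaches (trail′ ∷ʳ s) →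
          Reaches (trail′ ∷ʳ f (tr (tri c v (finM M vs) p)) (head c M))
        f-closes r5≡s = subst (λ s → Reaches (trail′ ∷ʳ s))
                              (sym (trans (f-same-counter {c} {v} {finM M vs} {p} {X} {M} {tt}) r5≡s))

        close : ∀ k → weight (other b) M vs ≡ k →
          Reaches (trail′ ∷ʳ f (tr (tri c v (finM M vs) p)) (head c M))
        close zero minority =
          f-closes (r5-single b b∈ (weight-zero⇒∉finM (other b) M vs minority)) (reaches-flood (trail c M vs))
        close (suc k) minority =
          f-closes (r5-full b b∈ (weight-pos⇒∈finM (other b) M vs (subst (0 <_) (sym minority) (s≤s z≤n))))
            (reaches-head k ∅ trail′ (trail-crossable c M vs) minority′ majority′)
          where
            weight′ : ∀ w → weight w ∅ (vals trail′) ≡ weight w M vs ∸ 1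
            weight′ w = trans (cong (weight w ∅) (vals-trail c M vs)) (weight-residue w M vs)
            minority′ : weight (other b) ∅ (vals trail′) ≡ k
            minority′ = trans (weight′ (other b)) (cong (_∸ 1) minority)
            majority′ : weight (other b) ∅ (vals trail′) < weight b ∅ (vals trail′)
            majority′ = subst₂ _<_ (sym minority′) (sym (weight′ b))
                          (∸-monoˡ-≤ 1 (subst (λ n → suc n ≤ weight b M vs) minority majority))

    reaches-constant : ∀ ys {a} → ys ≡ List.replicate (length ys) a → a ≡ b → Reaches (List.map bit ys)
    reaches-constant ys e refl = 0 , (begin
      List.map bit ys                                   ≡⟨ cong (List.map bit) e ⟩
      List.map bit (List.replicate (length ys) b)       ≡⟨ map-replicate bit (length ys) b ⟩
      List.replicate (length ys) (bit b)                ≡⟨ cong (λ l → List.replicate l (bit b)) (sym (length-map bit ys)) ⟩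
      List.replicate (length (List.map bit ys)) (bit b) ∎)

    reaches-border : ∀ y R → lastOr y R ≢ y → occ (other b) (List.map val (y ∷ R)) < occ b (List.map val (y ∷ R)) →
      Reaches (List.map bit (y ∷ R))
    reaches-border y R border majority =
      reaches-via 1 bordered (reaches-head _ ⁅ y ⁆ (List.map bit R) (bits-crossable ∘c R) refl majority′)
      where
        bordered : ticks 1 (List.map bit (y ∷ R)) ≡ List.map bit R ∷ʳ head ∘c ⁅ y ⁆
        bordered = cong (List.map bit R ∷ʳ_)
          (trans (cong (λ s → f s (bit y)) (lastOr-map bit y R)) (f-border (λ y≡a → border (sym y≡a))))

        counts : ∀ w → weight w ⁅ y ⁆ (vals (List.map bit R)) ≡ occ w (List.map val (y ∷ R))
        counts w = trans (weight-⁅⁆ w y _) (cong (λ l → occ w (val y ∷ l)) (sym (map-∘ R)))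

        majority′ : weight (other b) ⁅ y ⁆ (vals (List.map bit R)) < weight b ⁅ y ⁆ (vals (List.map bit R))
        majority′ = subst₂ _<_ (sym (counts (other b))) (sym (counts b)) majority

    reaches-bits : ∀ x₀ xs → occ (other b) (List.map val (x₀ ∷ xs)) < occ b (List.map val (x₀ ∷ xs)) →
      Reaches (List.map bit (x₀ ∷ xs))
    reaches-bits x₀ xs majority with replicate⊎break _≟_ (lastOr x₀ xs) (x₀ ∷ xs)
    ... | inj₁ e = reaches-constant (x₀ ∷ xs) e (constant-majority (x₀ ∷ xs) e majority)
    ... | inj₂ (k , y , zs , e , y≢a) =
      reaches-via k rotated (reaches-border y R (λ last≡y → y≢a (trans (sym last≡y) last-R)) majority′)
      where
        a = lastOr x₀ xs
        R = zs ++ List.replicate k a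

        last-zs : lastOr y zs ≡ a
        last-zs = begin
          lastOr y zs                                     ≡⟨ cong (λ d → lastOr d (y ∷ zs)) (sym (lastOr-replicate k a)) ⟩
          lastOr (lastOr a (List.replicate k a)) (y ∷ zs) ≡⟨ sym (lastOr-++ a (List.replicate k a) (y ∷ zs)) ⟩
          lastOr a (List.replicate k a ++ y ∷ zs)         ≡⟨ cong (lastOr a) (sym e) ⟩
          a                                               ∎

        last-R : lastOr y R ≡ a
        last-R = trans (lastOr-++ y zs (List.replicate k a))
                       (trans (cong (λ d → lastOr d (List.replicate k a)) last-zs) (lastOr-replicate k a))

        rotated : ticks k (List.map bit (x₀ ∷ xs)) ≡ List.map bit (y ∷ R)
        rotated = begin
          ticks k (List.map bit (x₀ ∷ xs))
            ≡⟨ cong (λ l → ticks k (List.map bit l)) e ⟩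
          ticks k (List.map bit (List.replicate k a ++ y ∷ zs))
            ≡⟨ cong (ticks k) (trans (map-++ bit (List.replicate k a) (y ∷ zs))
                                     (cong (_++ List.map bit (y ∷ zs)) (map-replicate bit k a))) ⟩
          ticks k (List.replicate k (bit a) ++ List.map bit (y ∷ zs))
            ≡⟨ ticks-rotate (f-quiescent a) k (List.map bit (y ∷ zs)) (trans (lastOr-map bit a (y ∷ zs)) (cong bit last-zs)) ⟩
          List.map bit (y ∷ zs) ++ List.replicate k (bit a)
            ≡⟨ cong (List.map bit (y ∷ zs) ++_) (sym (map-replicate bit k a)) ⟩
          List.map bit (y ∷ zs) ++ List.map bit (List.replicate k a)
            ≡⟨ sym (map-++ bit (y ∷ zs) (List.replicate k a)) ⟩
          List.map bit (y ∷ R) ∎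

        counts : ∀ w → occ w (List.map val (x₀ ∷ xs)) ≡ occ w (List.map val (y ∷ R))
        counts w = trans (cong (λ l → occ w (List.map val l)) e) (occ-map-val-++-comm w (List.replicate k a) (y ∷ zs))

        majority′ : occ (other b) (List.map val (y ∷ R)) < occ b (List.map val (y ∷ R))
        majority′ = subst₂ _<_ (counts (other b)) (counts b) majority

    reaches-vec : ∀ {n} (x : Vec 𝔹 (suc n)) → count (_≟ other b) x < count (_≟ b) x →
      ∃[ T ] ticks T (toList (map bit x)) ≡ List.replicate (suc n) (bit b)
    reaches-vec (x₀ ∷ x) majority
      with reaches-bits x₀ (toList x) (subst₂ _<_ (count≡occ (other b) (x₀ ∷ x)) (count≡occ b (x₀ ∷ x)) majority)
    ... | T , reach = T , (begin
      ticks T (toList (map bit (x₀ ∷ x)))                 ≡⟨ cong (ticks T) (toList-map bit (x₀ ∷ x)) ⟩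
      ticks T (List.map bit (x₀ ∷ toList x))              ≡⟨ reach ⟩
      List.replicate (length (List.map bit (x₀ ∷ toList x))) (bit b)
        ≡⟨ cong (λ l → List.replicate l (bit b)) (trans (length-map bit (x₀ ∷ toList x)) (length-toList (x₀ ∷ x))) ⟩
      List.replicate _ (bit b)                            ∎)

theorem1 : (g : Tri → Tri → Sym) → (n : ℕ) → (x : Vec 𝔹 (suc n)) → (b : 𝔹) →
    ((b' : 𝔹) → b' ≢ b → count (_≟ b') x < count (_≟ b) x) →
    (∃ λ K → ∀ k → k ≥ K →
        iter k (Rule.F g) (map bit x) ≡ replicate (suc n) (bit b))
    × (Rule.F g (replicate (suc n) (bit b)) ≡ replicate (suc n) (bit b))
theorem1 g n x b majority with Dynamics.Majority.reaches-vec g b x (majority (other b) (other-≢ b))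
... | T , reach = (T , iter-F-stable (map bit x) (f-quiescent b) reach) , F-replicate (f-quiescent b)
  where open Dynamics g
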